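{- Let $(a_n)_{n=1}^\infty$ be a non-decreasing sequence of positive integers with $a_1\geqslant 2$ and $a_n\to\infty$. Then for every $n\geqslant1$ there is exactly one positive integer $b_n$ satisfying $$\frac{1}{a_n}-\frac{1}{a_{n+1}-1}<\frac{1}{b_n}<\frac{1}{a_n-1}-\frac{1}{a_{n+1}}$$ if and only if $a_{n+1}-2\geqslant a_n\geqslant 2$ for all $n\geqslant 1$ and, for each $n$, one of the following holds: (i) $a_{n+1}-a_n-1$ divides $a_n^2$, and $a_{n+1}\geqslant \frac{\sqrt3}{2}\sqrt{4a_n^2-4a_n+3}+2a_n-\frac12$; (ii) $a_{n+1}-a_n-1$ does not divide $a_n^2$, and $\left\lfloor\frac{a_n^2}{a_{n+1}-a_n-1}\right\rfloor\leqslant\frac{(a_n-1)^2}{a_{n+1}-a_n+1}$. -}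

module Defs where

open import Data.Nat using (ℕ; zero; suc)
open import Data.Integer using (+_)
open import Data.Rational using (ℚ; _/_; 0ℚ; _≤_; _*_)
open import Data.Product using (_×_)

ι : ℕ → ℚ
ι k = + k / 1

-- 1/k for a positive integer k (convention: inv 0 = 0; only ever
-- applied to positive arguments in the statement)
inv : ℕ → ℚ
inv zero    = 0ℚ
inv (suc k) = + 1 / suc k

-- "√y ≤ x" for rationals y ≥ 0, x (no reals available):
-- √y ≤ x  ⇔  0 ≤ x ∧ y ≤ x²
SqrtLe : ℚ → ℚ → Set
SqrtLe y x = (0ℚ ≤ x) × (y ≤ x * x)

-- Put a = aₙ and c = aₙ₊₁. Clearing denominators, b satisfies the lower bound iff
-- (c − a − 1)·b < a(c − 1) and the upper bound iff (a − 1)·c < (c − a + 1)·b.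
-- If c ≤ a + 1 the lower bound holds for every b and the upper bound passes from b
-- to b + 1, so no solution is unique. Otherwise, with d = c − a − 1 ≥ 1, the solutions
-- form the interval β < b ≤ B with B = a + ⌊(a² − 1)/d⌋ and β = ⌊(a − 1)c/(d + 2)⌋.
-- Since β < B, the solution is unique iff B − 1 ≤ β, i.e. iff
-- (d + 2)·⌊(a² − 1)/d⌋ ≤ (a − 1)². If d ∤ a² the floor is ⌊a²/d⌋, which is (ii);
-- if a² = q·d it is q − 1, and multiplying by d turns the criterion into
-- 2a(a + d) ≤ d(d + 3), which is (i) after squaring.

module Submission where

open import Defs
open import Data.Nat using (ℕ; suc; _≤_; _∸_; _+_; _*_)
open import Data.Nat.Divisibility using (_∣_)
open import Data.Integer using (+_)
open import Data.Rational using (ℚ; floor; _/_) renaming (_<_ to _<ℚ_; _≤_ to _≤ℚ_; _-_ to _-ℚ_; _+_ to _+ℚ_; _*_ to _*ℚ_)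
open import Data.Product using (_×_; ∃; Σ)
open import Data.Sum using (_⊎_)
open import Relation.Nullary using (¬_)
open import Function.Bundles using (_⇔_)
open import Relation.Binary.PropositionalEquality using (_≡_)

open import Data.Nat using (zero; _<_; z≤n; s≤s; z<s; NonZero)
import Data.Nat.Properties as ℕ
import Data.Nat.DivMod as ℕ
import Data.Nat.Divisibility as ℕ
import Data.Nat.Tactic.RingSolver as ℕ-Solver
open import Data.Integer as ℤ using (ℤ; _⊖_; +≤+; +<+)
import Data.Integer.Properties as ℤ
import Data.Integer.DivMod as ℤ
import Data.Integer.Tactic.RingSolver as ℤ-Solver
open import Data.Rational as ℚ using (toℚᵘ)
import Data.Rational.Properties as ℚ
open import Data.Rational.Unnormalised as ℚᵘ using (ℚᵘ; mkℚᵘ; *<*; *≤*)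
  renaming (_/_ to _/ᵘ_; _≃_ to _≃ᵘ_)
import Data.Rational.Unnormalised.Properties as ℚᵘ
open import Data.Product using (_,_; proj₁; proj₂)
open import Data.Sum using (inj₁; inj₂; [_,_])
open import Data.Empty using (⊥-elim)
open import Function.Base using (_∘_)
open import Function.Bundles using (mk⇔; module Equivalence)
import Function.Properties.Equivalence as ⇔
open import Function.Related.Propositional using (module EquationalReasoning; equivalence)
open import Relation.Nullary using (Dec; yes; no)
open import Relation.Binary.PropositionalEquality
  using (_≢_; refl; sym; trans; cong; cong₂; subst; subst₂; module ≡-Reasoning)

module ⇔-Reasoning = EquationalReasoning {k = equivalence}

*≤⇔≤/ : ∀ {b n} d .{{_ : NonZero d}} → d * b ≤ n ⇔ b ≤ n ℕ./ d
*≤⇔≤/ {b} {n} d = mk⇔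
  (λ d*b≤n → subst (_≤ n ℕ./ d) (ℕ.m*n/n≡m b d) (ℕ./-monoˡ-≤ d (subst (_≤ n) (ℕ.*-comm d b) d*b≤n)))
  (λ b≤n/d → ℕ.≤-trans (ℕ.*-monoʳ-≤ d b≤n/d) (subst (_≤ n) (ℕ.*-comm (n ℕ./ d) d) (ℕ.m/n*n≤m n d)))

<*⇔/< : ∀ {b n} d .{{_ : NonZero d}} → n < d * b ⇔ n ℕ./ d < b
<*⇔/< {b} {n} d = mk⇔
  (λ n<d*b → ℕ.≰⇒> (ℕ.<⇒≱ n<d*b ∘ Equivalence.from (*≤⇔≤/ d)))
  (λ n/d<b → ℕ.≰⇒> (ℕ.<⇒≱ n/d<b ∘ Equivalence.to (*≤⇔≤/ d)))

n<d*[1+n/d] : ∀ n d .{{_ : NonZero d}} → n < d * suc (n ℕ./ d)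
n<d*[1+n/d] n d = Equivalence.from (<*⇔/< d) ℕ.≤-refl

∤[1+m]⇒m/n≡[1+m]/n : ∀ {m} d .{{_ : NonZero d}} → ¬ d ∣ suc m → m ℕ./ d ≡ suc m ℕ./ d
∤[1+m]⇒m/n≡[1+m]/n {m} d d∤1+m = ℕ.≤-antisym (ℕ./-monoˡ-≤ d (ℕ.n≤1+n m))
  (Equivalence.to (*≤⇔≤/ d) (ℕ.≤-pred (ℕ.≤∧≢⇒< d*q≤1+m (d∤1+m ∘ divides-by))))
  where
  d*q≤1+m : d * (suc m ℕ./ d) ≤ suc m
  d*q≤1+m = Equivalence.from (*≤⇔≤/ d) ℕ.≤-refl
  divides-by : d * (suc m ℕ./ d) ≡ suc m → d ∣ suc m
  divides-by eq = ℕ.divides (suc m ℕ./ d) (trans (sym eq) (ℕ.*-comm d _))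

[d*[1+i]∸1]/d≡i : ∀ i d .{{_ : NonZero d}} → (d * suc i ∸ 1) ℕ./ d ≡ i
[d*[1+i]∸1]/d≡i i d@(suc _) = ℕ.≤-antisym
  (ℕ.≤-pred (Equivalence.to (<*⇔/< d) ℕ.≤-refl))
  (Equivalence.to (*≤⇔≤/ d) (ℕ.≤-pred (ℕ.*-monoʳ-< d (ℕ.n<1+n i))))

+≡+⇒≤⇔≥ : ∀ {x y u v} → x + u ≡ y + v → u ≤ v ⇔ y ≤ x
+≡+⇒≤⇔≥ {x} {y} {u} {v} eq = mk⇔
  (λ u≤v → ℕ.+-cancelʳ-≤ v y x (subst (_≤ x + v) eq (ℕ.+-monoʳ-≤ x u≤v)))
  (λ y≤x → ℕ.+-cancelˡ-≤ x u v (subst (_≤ x + v) (sym eq) (ℕ.+-monoˡ-≤ v y≤x)))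

[1+a+d]∸a≡1+d : ∀ a d → suc (a + d) ∸ a ≡ suc d
[1+a+d]∸a≡1+d a d = trans (ℕ.+-∸-assoc 1 (ℕ.m≤m+n a d)) (cong suc (ℕ.m+n∸m≡n a d))

≤⇔0≤-ℤ : ∀ {i j} → i ℤ.≤ j ⇔ + 0 ℤ.≤ j ℤ.- i
≤⇔0≤-ℤ = mk⇔ ℤ.i≤j⇒0≤j-i ℤ.0≤i-j⇒j≤i

*-cancelʳ-≤⇔ : ∀ {i j} k → i ℤ.* + suc k ℤ.≤ j ℤ.* + suc k ⇔ i ℤ.≤ j
*-cancelʳ-≤⇔ {i} {j} k = mk⇔ (ℤ.*-cancelʳ-≤-pos i j (+ suc k)) (ℤ.*-monoʳ-≤-nonNeg (+ suc k))

*-cancelˡ-≤⇔ : ∀ {i j} k → + suc k ℤ.* i ℤ.≤ + suc k ℤ.* j ⇔ i ℤ.≤ j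
*-cancelˡ-≤⇔ {i} {j} k = mk⇔ (ℤ.*-cancelˡ-≤-pos i j (+ suc k)) (ℤ.*-monoˡ-≤-nonNeg (+ suc k))

+≤+⇔ : ∀ {m n} → + m ℤ.≤ + n ⇔ m ≤ n
+≤+⇔ = mk⇔ ℤ.drop‿+≤+ +≤+

⊖*<⇔∸*< : ∀ m n k {t} → 0 < t → (m ⊖ n) ℤ.* + k ℤ.< + t ⇔ (m ∸ n) * k < t
⊖*<⇔∸*< m n k 0<t with n ℕ.≤? m
... | yes n≤m rewrite ℤ.⊖-≥ n≤m | sym (ℤ.pos-* (m ∸ n) k) = mk⇔ ℤ.drop‿+<+ +<+
... | no n≰m rewrite ℤ.⊖-≰ n≰m | ℕ.m≤n⇒m∸n≡0 (ℕ.<⇒≤ (ℕ.≰⇒> n≰m)) = mk⇔ (λ _ → 0<t) (λ _ → negative<t)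
  where
  negative<t : ℤ.- + (n ∸ m) ℤ.* + k ℤ.< + _
  negative<t rewrite sym (ℤ.neg-distribˡ-* (+ (n ∸ m)) (+ k)) | sym (ℤ.pos-* (n ∸ m) k) =
    ℤ.≤-<-trans ℤ.neg-≤-pos (+<+ 0<t)

<⊖*⇔<∸* : ∀ m n k {t} → + t ℤ.< (m ⊖ n) ℤ.* + k ⇔ t < (m ∸ n) * k
<⊖*⇔<∸* m n k {t} with n ℕ.≤? m
... | yes n≤m rewrite ℤ.⊖-≥ n≤m | sym (ℤ.pos-* (m ∸ n) k) = mk⇔ ℤ.drop‿+<+ +<+
... | no n≰m rewrite ℤ.⊖-≰ n≰m | ℕ.m≤n⇒m∸n≡0 (ℕ.<⇒≤ (ℕ.≰⇒> n≰m)) = mk⇔ (⊥-elim ∘ ¬t<negative) λ ()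
  where
  ¬t<negative : ¬ (+ t ℤ.< ℤ.- + (n ∸ m) ℤ.* + k)
  ¬t<negative rewrite sym (ℤ.neg-distribˡ-* (+ (n ∸ m)) (+ k)) | sym (ℤ.pos-* (n ∸ m) k) =
    ℤ.≤⇒≯ ℤ.neg-≤-pos

private
  variable
    x y : ℚ
    X Y : ℚᵘ

toℚᵘ-/ : ∀ n d .{{_ : NonZero d}} → toℚᵘ (n / d) ≃ᵘ n /ᵘ d
toℚᵘ-/ n (suc k) = ℚ.toℚᵘ-fromℚᵘ (mkℚᵘ n k)

toℚᵘ-+ : toℚᵘ x ≃ᵘ X → toℚᵘ y ≃ᵘ Y → toℚᵘ (x +ℚ y) ≃ᵘ X ℚᵘ.+ Y
toℚᵘ-+ {x} {y = y} x≃X y≃Y = ℚᵘ.≃-trans (ℚ.toℚᵘ-homo-+ x y) (ℚᵘ.+-cong x≃X y≃Y)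

toℚᵘ-sub : toℚᵘ x ≃ᵘ X → toℚᵘ y ≃ᵘ Y → toℚᵘ (x -ℚ y) ≃ᵘ X ℚᵘ.- Y
toℚᵘ-sub {y = y} x≃X y≃Y =
  toℚᵘ-+ x≃X (ℚᵘ.≃-trans (ℚ.toℚᵘ-homo‿- y) (ℚᵘ.-‿cong y≃Y))

toℚᵘ-* : toℚᵘ x ≃ᵘ X → toℚᵘ y ≃ᵘ Y → toℚᵘ (x *ℚ y) ≃ᵘ X ℚᵘ.* Y
toℚᵘ-* {x} {y = y} x≃X y≃Y = ℚᵘ.≃-trans (ℚ.toℚᵘ-homo-* x y) (ℚᵘ.*-cong x≃X y≃Y)

<⇔*< : ∀ {n m d e} .{{_ : NonZero d}} .{{_ : NonZero e}} →
       toℚᵘ x ≃ᵘ n /ᵘ d → toℚᵘ y ≃ᵘ m /ᵘ e → x <ℚ y ⇔ n ℤ.* + e ℤ.< m ℤ.* + d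
<⇔*< {d = suc _} {e = suc _} x≃ y≃ = mk⇔
  (λ x<y → ℚᵘ.drop-*<* (ℚᵘ.<-respʳ-≃ y≃ (ℚᵘ.<-respˡ-≃ x≃ (ℚ.toℚᵘ-mono-< x<y))))
  (λ n<m → ℚ.toℚᵘ-cancel-< (ℚᵘ.<-respʳ-≃ (ℚᵘ.≃-sym y≃) (ℚᵘ.<-respˡ-≃ (ℚᵘ.≃-sym x≃) (*<* n<m))))

≤⇔*≤ : ∀ {n m d e} .{{_ : NonZero d}} .{{_ : NonZero e}} →
       toℚᵘ x ≃ᵘ n /ᵘ d → toℚᵘ y ≃ᵘ m /ᵘ e → x ≤ℚ y ⇔ n ℤ.* + e ℤ.≤ m ℤ.* + d
≤⇔*≤ {d = suc _} {e = suc _} x≃ y≃ = mk⇔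
  (λ x≤y → ℚᵘ.drop-*≤* (ℚᵘ.≤-respʳ-≃ y≃ (ℚᵘ.≤-respˡ-≃ x≃ (ℚ.toℚᵘ-mono-≤ x≤y))))
  (λ n≤m → ℚ.toℚᵘ-cancel-≤ (ℚᵘ.≤-respʳ-≃ (ℚᵘ.≃-sym y≃) (ℚᵘ.≤-respˡ-≃ (ℚᵘ.≃-sym x≃) (*≤* n≤m))))

toℚᵘ-inv-sub-inv : ∀ p q → toℚᵘ (inv (suc p) -ℚ inv (suc q)) ≃ᵘ (q ⊖ p) /ᵘ (suc p * suc q)
toℚᵘ-inv-sub-inv p q = ℚᵘ.≃-trans
  (toℚᵘ-sub (toℚᵘ-/ (+ 1) (suc p)) (toℚᵘ-/ (+ 1) (suc q)))
  (ℚᵘ.≃-reflexive (cong (λ n → n /ᵘ (suc p * suc q)) numerator≡))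
  where
  numerator≡ : + 1 ℤ.* + suc q ℤ.+ ℤ.- + 1 ℤ.* + suc p ≡ q ⊖ p
  numerator≡ = trans (cong₂ ℤ._+_ (ℤ.*-identityˡ (+ suc q)) (ℤ.-1*i≡-i (+ suc p)))
    (trans (ℤ.[+m]-[+n]≡m⊖n (suc q) (suc p)) (ℤ.[1+m]⊖[1+n]≡m⊖n q p))

inv-sub-inv<inv⇔ : ∀ p q b → inv (suc p) -ℚ inv (suc q) <ℚ inv (suc b) ⇔ (q ∸ p) * suc b < suc p * suc q
inv-sub-inv<inv⇔ p q b = begin
  inv (suc p) -ℚ inv (suc q) <ℚ inv (suc b)         ∼⟨ <⇔*< (toℚᵘ-inv-sub-inv p q) (toℚᵘ-/ (+ 1) (suc b)) ⟩
  (q ⊖ p) ℤ.* + suc b ℤ.< + 1 ℤ.* + (suc p * suc q) ≡⟨ cong ((q ⊖ p) ℤ.* + suc b ℤ.<_) (ℤ.*-identityˡ _) ⟩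
  (q ⊖ p) ℤ.* + suc b ℤ.< + (suc p * suc q)         ∼⟨ ⊖*<⇔∸*< q p (suc b) z<s ⟩
  (q ∸ p) * suc b < suc p * suc q                   ∎
  where open ⇔-Reasoning

inv<inv-sub-inv⇔ : ∀ p q b → inv (suc b) <ℚ inv (suc p) -ℚ inv (suc q) ⇔ suc p * suc q < (q ∸ p) * suc b
inv<inv-sub-inv⇔ p q b = begin
  inv (suc b) <ℚ inv (suc p) -ℚ inv (suc q)         ∼⟨ <⇔*< (toℚᵘ-/ (+ 1) (suc b)) (toℚᵘ-inv-sub-inv p q) ⟩
  + 1 ℤ.* + (suc p * suc q) ℤ.< (q ⊖ p) ℤ.* + suc b ≡⟨ cong (ℤ._< (q ⊖ p) ℤ.* + suc b) (ℤ.*-identityˡ _) ⟩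
  + (suc p * suc q) ℤ.< (q ⊖ p) ℤ.* + suc b         ∼⟨ <⊖*⇔<∸* q p (suc b) ⟩
  suc p * suc q < (q ∸ p) * suc b                   ∎
  where open ⇔-Reasoning

toℚᵘ-ι*inv : ∀ m k → toℚᵘ (ι m *ℚ inv (suc k)) ≃ᵘ + m /ᵘ suc k
toℚᵘ-ι*inv m k = ℚᵘ.≃-trans (toℚᵘ-* (toℚᵘ-/ (+ m) 1) (toℚᵘ-/ (+ 1) (suc k)))
  (ℚᵘ.*≡* (cong₂ ℤ._*_ (ℤ.*-identityʳ (+ m)) (cong +_ (sym (ℕ.*-identityˡ (suc k))))))

floor-≃ : ∀ {x} m k → toℚᵘ x ≃ᵘ + m /ᵘ suc k → floor x ≡ + (m ℕ./ suc k)
floor-≃ {ℚ.mkℚ (+ n) d _} m k (ℚᵘ.*≡* n*k≡m*d) = trans (ℤ.div-pos-is-/ℕ (+ n) (suc d)) (cong +_ (begin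
  n ℕ./ suc d                 ≡⟨ ℕ.m*n/o*n≡m/o n (suc k) (suc d) ⟨
  n * suc k ℕ./ (suc d * suc k) ≡⟨ cong (ℕ._/ (suc d * suc k)) (ℤ.+-injective (trans (ℤ.pos-* n (suc k)) (trans n*k≡m*d (sym (ℤ.pos-* m (suc d)))))) ⟩
  m * suc d ℕ./ (suc d * suc k) ≡⟨ cong (ℕ._/ (suc d * suc k)) (ℕ.*-comm m (suc d)) ⟩
  suc d * m ℕ./ (suc d * suc k) ≡⟨ ℕ.m*n/m*o≡n/o (suc d) m (suc k) ⟩
  m ℕ./ suc k                 ∎))
  where open ≡-Reasoning
floor-≃ {ℚ.mkℚ ℤ.-[1+ n ] d _} m k (ℚᵘ.*≡* -n*k≡m*d) = ⊥-elim (nonneg≢neg (trans (ℤ.pos-* m (suc d)) (sym -n*k≡m*d)))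
  where
  nonneg≢neg : ∀ {t} → + t ≢ ℤ.-[1+ n ] ℤ.* + suc k
  nonneg≢neg ()

floor[ι*inv]≤ι*inv⇔ : ∀ m k n e →
  floor (ι m *ℚ inv (suc k)) / 1 ≤ℚ ι n *ℚ inv (suc e) ⇔ m ℕ./ suc k * suc e ≤ n
floor[ι*inv]≤ι*inv⇔ m k n e = begin
  floor (ι m *ℚ inv (suc k)) / 1 ≤ℚ ι n *ℚ inv (suc e)
    ≡⟨ cong (λ z → z / 1 ≤ℚ ι n *ℚ inv (suc e)) (floor-≃ m k (toℚᵘ-ι*inv m k)) ⟩
  ι (m ℕ./ suc k) ≤ℚ ι n *ℚ inv (suc e)
    ∼⟨ ≤⇔*≤ (toℚᵘ-/ (+ (m ℕ./ suc k)) 1) (toℚᵘ-ι*inv n e) ⟩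
  + (m ℕ./ suc k) ℤ.* + suc e ℤ.≤ + n ℤ.* + 1
    ≡⟨ cong₂ ℤ._≤_ (sym (ℤ.pos-* (m ℕ./ suc k) (suc e))) (ℤ.*-identityʳ (+ n)) ⟩
  + (m ℕ./ suc k * suc e) ℤ.≤ + n
    ∼⟨ mk⇔ ℤ.drop‿+≤+ +≤+ ⟩
  m ℕ./ suc k * suc e ≤ n ∎
  where open ⇔-Reasoning

square-identity : ∀ A D →
  (+ 2 ℤ.* D ℤ.+ + 3 ℤ.- + 2 ℤ.* A) ℤ.* (+ 2 ℤ.* D ℤ.+ + 3 ℤ.- + 2 ℤ.* A)
    ℤ.- + 3 ℤ.* (+ 4 ℤ.* A ℤ.* A ℤ.- + 4 ℤ.* A ℤ.+ + 3)
  ≡ + 4 ℤ.* (D ℤ.* (D ℤ.+ + 3)) ℤ.- + 4 ℤ.* (+ 2 ℤ.* A ℤ.* (A ℤ.+ D))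
square-identity = ℤ-Solver.solve-∀

2a[a+d]≤d[d+3]⇒2a≤2d+3 : ∀ a d → 2 * a * (a + d) ≤ d * (d + 3) → 2 * a ≤ 2 * d + 3
2a[a+d]≤d[d+3]⇒2a≤2d+3 a d h with a ℕ.≤? suc d
... | yes a≤1+d = ℕ.≤-trans (ℕ.*-monoʳ-≤ 2 a≤1+d)
                   (ℕ.≤-trans (ℕ.m≤m+n (2 * suc d) 1) (ℕ.≤-reflexive (2[1+d]+1≡2d+3 d)))
  where
  2[1+d]+1≡2d+3 : ∀ d → 2 * suc d + 1 ≡ 2 * d + 3
  2[1+d]+1≡2d+3 = ℕ-Solver.solve-∀
... | no a≰1+d = ⊥-elim (ℕ.<⇒≱ (ℕ.<-≤-trans d[d+3]<bound bound≤2a[a+d]) h)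
  where
  2+d≤a : 2 + d ≤ a
  2+d≤a = ℕ.≰⇒> a≰1+d
  bound≡ : ∀ d → 2 * (2 + d) * ((2 + d) + d) ≡ suc (d * (d + 3)) + (3 * d * d + 9 * d + 7)
  bound≡ = ℕ-Solver.solve-∀
  d[d+3]<bound : d * (d + 3) < 2 * (2 + d) * ((2 + d) + d)
  d[d+3]<bound = ℕ.≤-trans (ℕ.m≤m+n _ _) (ℕ.≤-reflexive (sym (bound≡ d)))
  bound≤2a[a+d] : 2 * (2 + d) * ((2 + d) + d) ≤ 2 * a * (a + d)
  bound≤2a[a+d] = ℕ.*-mono-≤ (ℕ.*-monoʳ-≤ 2 2+d≤a) (ℕ.+-monoˡ-≤ d 2+d≤a)

toℚᵘ[1+a+d-2a+½] : ∀ a d →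
  toℚᵘ (ι (suc (a + d)) -ℚ ι (2 * a) +ℚ (+ 1 / 2)) ≃ᵘ (+ 2 ℤ.* + d ℤ.+ + 3 ℤ.- + 2 ℤ.* + a) /ᵘ 2
toℚᵘ[1+a+d-2a+½] a d = ℚᵘ.≃-trans
  (toℚᵘ-+ (toℚᵘ-sub (toℚᵘ-/ (+ suc (a + d)) 1) (toℚᵘ-/ (+ (2 * a)) 1)) (toℚᵘ-/ (+ 1) 2))
  (ℚᵘ.*≡* (cong (ℤ._* + 2) (trans (cong₂ numerator c≡ (ℤ.pos-* 2 a)) (numerator≡ (+ a) (+ d)))))
  where
  numerator≡ : ∀ A D →
    ((+ 1 ℤ.+ (A ℤ.+ D)) ℤ.* + 1 ℤ.+ ℤ.- (+ 2 ℤ.* A) ℤ.* + 1) ℤ.* + 2 ℤ.+ + 1 ℤ.* + 1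
    ≡ + 2 ℤ.* D ℤ.+ + 3 ℤ.- + 2 ℤ.* A
  numerator≡ = ℤ-Solver.solve-∀
  numerator : ℤ → ℤ → ℤ
  numerator C A2 = (C ℤ.* + 1 ℤ.+ ℤ.- A2 ℤ.* + 1) ℤ.* + 2 ℤ.+ + 1 ℤ.* + 1
  c≡ : + suc (a + d) ≡ + 1 ℤ.+ (+ a ℤ.+ + d)
  c≡ = trans (ℤ.pos-+ 1 (a + d)) (cong (ℤ._+_ (+ 1)) (ℤ.pos-+ a d))

pos[4aa∸4a+3] : ∀ a .{{_ : NonZero a}} →
  + (4 * a * a ∸ 4 * a + 3) ≡ + 4 ℤ.* + a ℤ.* + a ℤ.- + 4 ℤ.* + a ℤ.+ + 3
pos[4aa∸4a+3] a = begin
  + (4 * a * a ∸ 4 * a + 3)                 ≡⟨ ℤ.pos-+ (4 * a * a ∸ 4 * a) 3 ⟩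
  + (4 * a * a ∸ 4 * a) ℤ.+ + 3             ≡⟨ cong (ℤ._+ + 3) (ℤ.⊖-≥ (ℕ.m≤m*n (4 * a) a)) ⟨
  (4 * a * a) ⊖ (4 * a) ℤ.+ + 3             ≡⟨ cong (ℤ._+ + 3) (ℤ.[+m]-[+n]≡m⊖n (4 * a * a) (4 * a)) ⟨
  + (4 * a * a) ℤ.- + (4 * a) ℤ.+ + 3       ≡⟨ cong₂ (λ u v → u ℤ.- v ℤ.+ + 3) 4aa≡ (ℤ.pos-* 4 a) ⟩
  + 4 ℤ.* + a ℤ.* + a ℤ.- + 4 ℤ.* + a ℤ.+ + 3 ∎
  where
  open ≡-Reasoning
  4aa≡ : + (4 * a * a) ≡ + 4 ℤ.* + a ℤ.* + a
  4aa≡ = trans (ℤ.pos-* (4 * a) a) (cong (ℤ._* + a) (ℤ.pos-* 4 a))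

sqrtLe⇔ : ∀ a d .{{_ : NonZero a}} →
  SqrtLe ((+ 3 / 4) *ℚ ι (4 * a * a ∸ 4 * a + 3)) (ι (suc (a + d)) -ℚ ι (2 * a) +ℚ (+ 1 / 2))
  ⇔ 2 * a * (a + d) ≤ d * (d + 3)
sqrtLe⇔ a d = mk⇔
  (Equivalence.to square⇔ ∘ proj₂)
  (λ h → nonneg (2a[a+d]≤d[d+3]⇒2a≤2d+3 a d h) , Equivalence.from square⇔ h)
  where
  A D N : ℤ
  A = + a
  D = + d
  N = + 2 ℤ.* D ℤ.+ + 3 ℤ.- + 2 ℤ.* A

  radicand excess : ℚ
  radicand = (+ 3 / 4) *ℚ ι (4 * a * a ∸ 4 * a + 3)
  excess = ι (suc (a + d)) -ℚ ι (2 * a) +ℚ (+ 1 / 2)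

  square⇔ : radicand ≤ℚ excess *ℚ excess ⇔ 2 * a * (a + d) ≤ d * (d + 3)
  square⇔ = begin
    radicand ≤ℚ excess *ℚ excess
      ∼⟨ ≤⇔*≤ (toℚᵘ-* (toℚᵘ-/ (+ 3) 4) (toℚᵘ-/ (+ (4 * a * a ∸ 4 * a + 3)) 1)) (toℚᵘ-* (toℚᵘ[1+a+d-2a+½] a d) (toℚᵘ[1+a+d-2a+½] a d)) ⟩
    + 3 ℤ.* + (4 * a * a ∸ 4 * a + 3) ℤ.* + 4 ℤ.≤ N ℤ.* N ℤ.* + 4
      ∼⟨ *-cancelʳ-≤⇔ 3 ⟩
    + 3 ℤ.* + (4 * a * a ∸ 4 * a + 3) ℤ.≤ N ℤ.* N
      ∼⟨ ≤⇔0≤-ℤ ⟩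
    + 0 ℤ.≤ N ℤ.* N ℤ.- + 3 ℤ.* + (4 * a * a ∸ 4 * a + 3)
      ≡⟨ cong (λ K → + 0 ℤ.≤ N ℤ.* N ℤ.- + 3 ℤ.* K) (pos[4aa∸4a+3] a) ⟩
    + 0 ℤ.≤ N ℤ.* N ℤ.- + 3 ℤ.* (+ 4 ℤ.* A ℤ.* A ℤ.- + 4 ℤ.* A ℤ.+ + 3)
      ≡⟨ cong (+ 0 ℤ.≤_) (square-identity A D) ⟩
    + 0 ℤ.≤ + 4 ℤ.* (D ℤ.* (D ℤ.+ + 3)) ℤ.- + 4 ℤ.* (+ 2 ℤ.* A ℤ.* (A ℤ.+ D))
      ∼⟨ ⇔.sym ≤⇔0≤-ℤ ⟩
    + 4 ℤ.* (+ 2 ℤ.* A ℤ.* (A ℤ.+ D)) ℤ.≤ + 4 ℤ.* (D ℤ.* (D ℤ.+ + 3))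
      ∼⟨ *-cancelˡ-≤⇔ 3 ⟩
    + 2 ℤ.* A ℤ.* (A ℤ.+ D) ℤ.≤ D ℤ.* (D ℤ.+ + 3)
      ≡⟨ cong₂ ℤ._≤_ 2a[a+d]≡ d[d+3]≡ ⟨
    + (2 * a * (a + d)) ℤ.≤ + (d * (d + 3))
      ∼⟨ +≤+⇔ ⟩
    2 * a * (a + d) ≤ d * (d + 3) ∎
    where
    open ⇔-Reasoning
    2a[a+d]≡ : + (2 * a * (a + d)) ≡ + 2 ℤ.* A ℤ.* (A ℤ.+ D)
    2a[a+d]≡ = trans (ℤ.pos-* (2 * a) (a + d)) (cong₂ ℤ._*_ (ℤ.pos-* 2 a) (ℤ.pos-+ a d))
    d[d+3]≡ : + (d * (d + 3)) ≡ D ℤ.* (D ℤ.+ + 3)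
    d[d+3]≡ = trans (ℤ.pos-* d (d + 3)) (cong (D ℤ.*_) (ℤ.pos-+ d 3))

  nonneg : 2 * a ≤ 2 * d + 3 → ℚ.0ℚ ≤ℚ excess
  nonneg 2a≤2d+3 = Equivalence.from (≤⇔*≤ ℚᵘ.≃-refl (toℚᵘ[1+a+d-2a+½] a d))
    (subst (+ 0 ℤ.≤_) (sym (ℤ.*-identityʳ N)) (ℤ.i≤j⇒0≤j-i (subst₂ ℤ._≤_ 2a≡ 2d+3≡ (+≤+ 2a≤2d+3))))
    where
    2a≡ : + (2 * a) ≡ + 2 ℤ.* A
    2a≡ = ℤ.pos-* 2 a
    2d+3≡ : + (2 * d + 3) ≡ + 2 ℤ.* D ℤ.+ + 3
    2d+3≡ = trans (ℤ.pos-+ (2 * d) 3) (cong (ℤ._+ + 3) (ℤ.pos-* 2 d))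

UniqueSolution : (ℕ → Set) → (ℕ → Set) → Set
UniqueSolution P Q = ∃ λ b → 1 ≤ b × P b × Q b × (∀ b′ → 1 ≤ b′ → P b′ → Q b′ → b′ ≡ b)

UniqueSolution-cong : ∀ {P P′ Q Q′ : ℕ → Set} →
  (∀ {b} → 1 ≤ b → P b ⇔ P′ b) → (∀ {b} → 1 ≤ b → Q b ⇔ Q′ b) →
  UniqueSolution P Q ⇔ UniqueSolution P′ Q′
UniqueSolution-cong P⇔P′ Q⇔Q′ = mk⇔
  (λ (b , 1≤b , Pb , Qb , unique) → b , 1≤b , to (P⇔P′ 1≤b) Pb , to (Q⇔Q′ 1≤b) Qb ,
     λ b′ 1≤b′ P′b′ Q′b′ → unique b′ 1≤b′ (from (P⇔P′ 1≤b′) P′b′) (from (Q⇔Q′ 1≤b′) Q′b′))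
  (λ (b , 1≤b , P′b , Q′b , unique) → b , 1≤b , from (P⇔P′ 1≤b) P′b , from (Q⇔Q′ 1≤b) Q′b ,
     λ b′ 1≤b′ Pb′ Qb′ → unique b′ 1≤b′ (to (P⇔P′ 1≤b′) Pb′) (to (Q⇔Q′ 1≤b′) Qb′))
  where open Equivalence

uniqueSolution-interval⇔ : ∀ β B → UniqueSolution (_≤ B) (β <_) ⇔ suc β ≡ B
uniqueSolution-interval⇔ β B = mk⇔
  (λ (b , 1≤b , b≤B , β<b , unique) →
     trans (unique (suc β) (s≤s z≤n) (ℕ.≤-trans β<b b≤B) ℕ.≤-refl)
           (sym (unique B (ℕ.≤-trans 1≤b b≤B) ℕ.≤-refl (ℕ.<-≤-trans β<b b≤B))))
  (λ { refl → suc β , s≤s z≤n , ℕ.≤-refl , ℕ.≤-refl , λ b′ _ b′≤1+β β<b′ → ℕ.≤-antisym b′≤1+β β<b′ })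

¬uniqueSolution-unbounded : ∀ {P Q : ℕ → Set} →
  (∀ {b} → 1 ≤ b → P b) → (∀ {b} → 1 ≤ b → Q b → Q (suc b)) → ¬ UniqueSolution P Q
¬uniqueSolution-unbounded P-all Q-suc (b , 1≤b , _ , Qb , unique) =
  ℕ.1+n≢n (unique (suc b) (s≤s z≤n) (P-all (s≤s z≤n)) (Q-suc 1≤b Qb))

Lower Upper : ℕ → ℕ → ℕ → Set
Lower a c b = inv a -ℚ inv (c ∸ 1) <ℚ inv b
Upper a c b = inv b <ℚ inv (a ∸ 1) -ℚ inv c

Criterion : (a d : ℕ) .{{_ : NonZero d}} → Set
Criterion a d = (2 + d) * ((a * a ∸ 1) ℕ./ d) ≤ (a ∸ 1) * (a ∸ 1)

d*b<a*[a+d]⇔b≤a+[a*a∸1]/d : ∀ a d .{{_ : NonZero a}} .{{_ : NonZero d}} {b} →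
  d * b < a * (a + d) ⇔ b ≤ a + (a * a ∸ 1) ℕ./ d
d*b<a*[a+d]⇔b≤a+[a*a∸1]/d a@(suc _) d {b} = mk⇔
  (λ d*b<a[a+d] → ℕ.≮⇒≥ (λ a+r<b → ℕ.<⇒≱ d*b<a[a+d] (a[a+d]≤d*b a+r<b)))
  d*b<a[a+d]
  where
  open ℕ.≤-Reasoning
  r : ℕ
  r = (a * a ∸ 1) ℕ./ d
  d*r<a*a : d * r < a * a
  d*r<a*a = s≤s (Equivalence.from (*≤⇔≤/ d) ℕ.≤-refl)
  a[a+d]≡ : a * (a + d) ≡ d * a + a * a
  a[a+d]≡ = trans (ℕ.*-distribˡ-+ a a d) (trans (ℕ.+-comm (a * a) (a * d)) (cong (_+ a * a) (ℕ.*-comm a d)))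
  a[a+d]≤d*b : a + r < b → a * (a + d) ≤ d * b
  a[a+d]≤d*b a+r<b = begin
    a * (a + d)     ≡⟨ a[a+d]≡ ⟩
    d * a + a * a   ≤⟨ ℕ.+-monoʳ-≤ (d * a) (n<d*[1+n/d] (a * a ∸ 1) d) ⟩
    d * a + d * suc r ≡⟨ ℕ.*-distribˡ-+ d a (suc r) ⟨
    d * (a + suc r) ≤⟨ ℕ.*-monoʳ-≤ d (subst (_≤ b) (sym (ℕ.+-suc a r)) a+r<b) ⟩
    d * b           ∎
  d*b<a[a+d] : b ≤ a + r → d * b < a * (a + d)
  d*b<a[a+d] b≤a+r = begin-strict
    d * b           ≤⟨ ℕ.*-monoʳ-≤ d b≤a+r ⟩
    d * (a + r)     ≡⟨ ℕ.*-distribˡ-+ d a r ⟩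
    d * a + d * r   <⟨ ℕ.+-monoʳ-< (d * a) d*r<a*a ⟩
    d * a + a * a   ≡⟨ a[a+d]≡ ⟨
    a * (a + d)     ∎

[a∸1]*[1+a+d]<[2+d]*[a+[a*a∸1]/d] : ∀ a d .{{_ : NonZero a}} .{{_ : NonZero d}} →
  (a ∸ 1) * suc (a + d) < (2 + d) * (a + (a * a ∸ 1) ℕ./ d)
[a∸1]*[1+a+d]<[2+d]*[a+[a*a∸1]/d] a@(suc m) d = begin-strict
  m * suc (a + d)           <⟨ ℕ.≤-reflexive (1+m*[2+m+d]≡ m d) ⟩
  a * a + m * d             ≤⟨ ℕ.+-monoˡ-≤ (m * d) (n<d*[1+n/d] (a * a ∸ 1) d) ⟩
  d * suc r + m * d         ≤⟨ ℕ.m≤m+n _ _ ⟩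
  d * suc r + m * d + 2 * (a + r) ≡⟨ [2+d][1+m+r]≡ m d r ⟨
  (2 + d) * (a + r)         ∎
  where
  open ℕ.≤-Reasoning
  r : ℕ
  r = (a * a ∸ 1) ℕ./ d
  1+m*[2+m+d]≡ : ∀ m d → suc (m * suc (suc m + d)) ≡ suc m * suc m + m * d
  1+m*[2+m+d]≡ = ℕ-Solver.solve-∀
  [2+d][1+m+r]≡ : ∀ m d r → (2 + d) * (suc m + r) ≡ d * suc r + m * d + 2 * (suc m + r)
  [2+d][1+m+r]≡ = ℕ-Solver.solve-∀

uniqueSolution⇔criterion : ∀ {a c} d .{{_ : NonZero d}} → 2 ≤ a → c ≡ suc (a + d) →
  UniqueSolution (Lower a c) (Upper a c) ⇔ Criterion a d
uniqueSolution⇔criterion {a@(suc m@(suc p))} d (s≤s (s≤s z≤n)) refl = begin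
  UniqueSolution (Lower a c) (Upper a c)        ∼⟨ UniqueSolution-cong lower⇔ upper⇔ ⟩
  UniqueSolution (_≤ a + r) (β <_)              ∼⟨ uniqueSolution-interval⇔ β (a + r) ⟩
  suc β ≡ a + r                                 ∼⟨ mk⇔ (ℕ.≤-reflexive ∘ sym) (ℕ.≤-antisym β<a+r) ⟩
  suc (m + r) ≤ suc β                           ∼⟨ mk⇔ ℕ.≤-pred s≤s ⟩
  m + r ≤ β                                     ∼⟨ ⇔.sym (*≤⇔≤/ (2 + d)) ⟩
  (2 + d) * (m + r) ≤ m * c                     ≡⟨ cong₂ _≤_ (ℕ.*-distribˡ-+ (2 + d) m r) (m*c≡ m d) ⟩
  (2 + d) * m + (2 + d) * r ≤ (2 + d) * m + m * m ∼⟨ mk⇔ (ℕ.+-cancelˡ-≤ _ _ _) (ℕ.+-monoʳ-≤ _) ⟩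
  (2 + d) * r ≤ m * m                           ∎
  where
  open ⇔-Reasoning
  c r β : ℕ
  c = suc (a + d)
  r = (a * a ∸ 1) ℕ./ d
  β = m * c ℕ./ (2 + d)

  m*c≡ : ∀ m d → m * suc (suc m + d) ≡ (2 + d) * m + m * m
  m*c≡ = ℕ-Solver.solve-∀

  lower⇔ : ∀ {b} → 1 ≤ b → Lower a c b ⇔ b ≤ a + r
  lower⇔ {suc b} _ = begin
    Lower a c (suc b)                   ∼⟨ inv-sub-inv<inv⇔ m (m + d) b ⟩
    (m + d ∸ m) * suc b < a * (a + d)   ≡⟨ cong (λ x → x * suc b < a * (a + d)) (ℕ.m+n∸m≡n m d) ⟩
    d * suc b < a * (a + d)             ∼⟨ d*b<a*[a+d]⇔b≤a+[a*a∸1]/d a d ⟩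
    suc b ≤ a + r                       ∎

  upper⇔ : ∀ {b} → 1 ≤ b → Upper a c b ⇔ β < b
  upper⇔ {suc b} _ = begin
    Upper a c (suc b)                   ∼⟨ inv<inv-sub-inv⇔ p (a + d) b ⟩
    m * c < (a + d ∸ p) * suc b         ≡⟨ cong (λ x → m * c < x * suc b) a+d∸p≡2+d ⟩
    m * c < (2 + d) * suc b             ∼⟨ <*⇔/< (2 + d) ⟩
    β < suc b                           ∎
    where
    a+d∸p≡2+d : a + d ∸ p ≡ 2 + d
    a+d∸p≡2+d = trans (ℕ.+-∸-assoc 2 (ℕ.m≤m+n p d)) (cong (_+_ 2) (ℕ.m+n∸m≡n p d))

  β<a+r : β < a + r
  β<a+r = Equivalence.to (<*⇔/< (2 + d)) ([a∸1]*[1+a+d]<[2+d]*[a+[a*a∸1]/d] a d)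

-- d and e stand for c − a − 1 and c − a + 1; as parameters they can be rewritten.
PaperCondition : (a c d e : ℕ) → Set
PaperCondition a c d e =
  ((d ∣ (a * a)) × SqrtLe ((+ 3 / 4) *ℚ ι (4 * a * a ∸ 4 * a + 3)) (ι c -ℚ ι (2 * a) +ℚ (+ 1 / 2)))
  ⊎ ((¬ (d ∣ (a * a))) × ((floor (ι (a * a) *ℚ inv d) / 1) ≤ℚ ι ((a ∸ 1) * (a ∸ 1)) *ℚ inv e))

×⊎¬×⇔ˡ : ∀ {P A B : Set} → P → ((P × A) ⊎ (¬ P × B)) ⇔ A
×⊎¬×⇔ˡ p = mk⇔ [ proj₂ , (λ (¬p , _) → ⊥-elim (¬p p)) ] (λ a → inj₁ (p , a))

×⊎¬×⇔ʳ : ∀ {P A B : Set} → ¬ P → ((P × A) ⊎ (¬ P × B)) ⇔ B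
×⊎¬×⇔ʳ ¬p = mk⇔ [ (λ (p , _) → ⊥-elim (¬p p)) , proj₂ ] (λ b → inj₂ (¬p , b))

∣⇒criterion⇔ : ∀ a d .{{_ : NonZero a}} .{{_ : NonZero d}} → d ∣ a * a →
  Criterion a d ⇔ 2 * a * (a + d) ≤ d * (d + 3)
∣⇒criterion⇔ a@(suc m) d (ℕ.divides (suc i) a*a≡[1+i]*d) = let open ⇔-Reasoning in begin
  (2 + d) * ((a * a ∸ 1) ℕ./ d) ≤ m * m ≡⟨ cong (λ q → (2 + d) * q ≤ m * m) r≡i ⟩
  (2 + d) * i ≤ m * m                 ∼⟨ mk⇔ (ℕ.*-monoʳ-≤ d) (ℕ.*-cancelˡ-≤ d) ⟩
  d * ((2 + d) * i) ≤ d * (m * m)     ∼⟨ +≡+⇒≤⇔≥ cross-identity ⟩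
  2 * a * (a + d) ≤ d * (d + 3)       ∎
  where
  a*a≡d*[1+i] : a * a ≡ d * suc i
  a*a≡d*[1+i] = trans a*a≡[1+i]*d (ℕ.*-comm (suc i) d)
  r≡i : (a * a ∸ 1) ℕ./ d ≡ i
  r≡i = trans (cong (λ n → (n ∸ 1) ℕ./ d) a*a≡d*[1+i]) ([d*[1+i]∸1]/d≡i i d)
  cross-identity : d * (d + 3) + d * ((2 + d) * i) ≡ 2 * a * (a + d) + d * (m * m)
  cross-identity = begin
    d * (d + 3) + d * ((2 + d) * i) ≡⟨ lhs≡ d i ⟩
    (2 + d) * (d * suc i) + d       ≡⟨ cong (λ n → (2 + d) * n + d) a*a≡d*[1+i] ⟨
    (2 + d) * (a * a) + d           ≡⟨ rhs≡ m d ⟩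
    2 * a * (a + d) + d * (m * m)   ∎
    where
    open ≡-Reasoning
    lhs≡ : ∀ d i → d * (d + 3) + d * ((2 + d) * i) ≡ (2 + d) * (d * suc i) + d
    lhs≡ = ℕ-Solver.solve-∀
    rhs≡ : ∀ m d → (2 + d) * (suc m * suc m) + d ≡ 2 * suc m * (suc m + d) + d * (m * m)
    rhs≡ = ℕ-Solver.solve-∀
∣⇒criterion⇔ (suc m) d (ℕ.divides zero ())

∤⇒criterion⇔ : ∀ a d .{{_ : NonZero a}} .{{_ : NonZero d}} → ¬ d ∣ a * a →
  Criterion a d ⇔ (a * a) ℕ./ d * (2 + d) ≤ (a ∸ 1) * (a ∸ 1)
∤⇒criterion⇔ a@(suc _) d d∤a*a rewrite ∤[1+m]⇒m/n≡[1+m]/n d d∤a*a | ℕ.*-comm (2 + d) ((a * a) ℕ./ d) = ⇔.refl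

paperCondition⇔criterion : ∀ {a c} d .{{_ : NonZero d}} → 1 ≤ a → c ≡ suc (a + d) →
  PaperCondition a c (c ∸ a ∸ 1) (c ∸ a + 1) ⇔ Criterion a d
paperCondition⇔criterion {a@(suc m)} d@(suc k) _ refl = let open ⇔-Reasoning in begin
  PaperCondition a c (c ∸ a ∸ 1) (c ∸ a + 1) ≡⟨ cong₂ (PaperCondition a c) d≡ e≡ ⟩
  PaperCondition a c d (2 + d)               ∼⟨ by-divisibility (d ℕ.∣? a * a) ⟩
  Criterion a d                              ∎
  where
  c : ℕ
  c = suc (a + d)
  d≡ : c ∸ a ∸ 1 ≡ d
  d≡ = cong (_∸ 1) ([1+a+d]∸a≡1+d a d)
  e≡ : c ∸ a + 1 ≡ 2 + d
  e≡ = trans (cong (_+ 1) ([1+a+d]∸a≡1+d a d)) (ℕ.+-comm (suc d) 1)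
  by-divisibility : Dec (d ∣ a * a) → PaperCondition a c d (2 + d) ⇔ Criterion a d
  by-divisibility (yes d∣a*a) =
    ⇔.trans (×⊎¬×⇔ˡ d∣a*a) (⇔.trans (sqrtLe⇔ a d) (⇔.sym (∣⇒criterion⇔ a d d∣a*a)))
  by-divisibility (no d∤a*a) =
    ⇔.trans (×⊎¬×⇔ʳ d∤a*a) (⇔.trans (floor[ι*inv]≤ι*inv⇔ (a * a) k (m * m) (suc d)) (⇔.sym (∤⇒criterion⇔ a d d∤a*a)))

¬uniqueSolution-c≤1+a : ∀ {a c} → 2 ≤ a → a ≤ c → c ≤ suc a → ¬ UniqueSolution (Lower a c) (Upper a c)
¬uniqueSolution-c≤1+a {suc (suc p)} {suc (suc q)} (s≤s (s≤s z≤n)) (s≤s (s≤s _)) (s≤s (s≤s q≤1+p)) =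
  ¬uniqueSolution-unbounded lower-everywhere upper-suc
  where
  open Equivalence
  lower-everywhere : ∀ {b} → 1 ≤ b → Lower (suc (suc p)) (suc (suc q)) b
  lower-everywhere {suc b} _ = from (inv-sub-inv<inv⇔ (suc p) q b)
    (subst (λ x → x * suc b < suc (suc p) * suc q) (sym (ℕ.m≤n⇒m∸n≡0 q≤1+p)) z<s)
  upper-suc : ∀ {b} → 1 ≤ b → Upper (suc (suc p)) (suc (suc q)) b → Upper (suc (suc p)) (suc (suc q)) (suc b)
  upper-suc {suc b} _ upper = from (inv<inv-sub-inv⇔ p (suc q) (suc b))
    (ℕ.<-≤-trans (to (inv<inv-sub-inv⇔ p (suc q) b) upper) (ℕ.*-monoʳ-≤ (suc q ∸ p) (ℕ.n≤1+n (suc b))))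

a≤c∸2⇒c≡1+a+[1+k] : ∀ {a c} → 2 ≤ c → a ≤ c ∸ 2 → ∃ λ k → c ≡ suc (a + suc k)
a≤c∸2⇒c≡1+a+[1+k] {a} {suc (suc q)} (s≤s (s≤s _)) a≤q with ℕ.m≤n⇒∃[o]m+o≡n a≤q
... | k , a+k≡q = k , cong suc (trans (cong suc (sym a+k≡q)) (sym (ℕ.+-suc a k)))

uniqueSolution⇔paperCondition : ∀ {a c} → 2 ≤ a → a ≤ c →
  UniqueSolution (Lower a c) (Upper a c) ⇔ (a ≤ c ∸ 2 × PaperCondition a c (c ∸ a ∸ 1) (c ∸ a + 1))
uniqueSolution⇔paperCondition {a} {c} 2≤a a≤c with a ℕ.≤? c ∸ 2
... | no a≰c∸2 = mk⇔ (⊥-elim ∘ ¬uniqueSolution-c≤1+a 2≤a a≤c c≤1+a) (⊥-elim ∘ a≰c∸2 ∘ proj₁)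
  where
  c≤1+a : c ≤ suc a
  c≤1+a = ℕ.≮⇒≥ (a≰c∸2 ∘ ℕ.∸-monoˡ-≤ 2)
... | yes a≤c∸2 with a≤c∸2⇒c≡1+a+[1+k] (ℕ.≤-trans 2≤a a≤c) a≤c∸2
... | k , c≡1+a+[1+k] = ⇔.trans (uniqueSolution⇔criterion (suc k) 2≤a c≡1+a+[1+k])
  (⇔.trans (⇔.sym (paperCondition⇔criterion (suc k) (ℕ.≤-trans (s≤s z≤n) 2≤a) c≡1+a+[1+k]))
           (mk⇔ (a≤c∸2 ,_) proj₂))

proposition4 : (a : ℕ → ℕ)
  → (∀ n → 1 ≤ n → a n ≤ a (suc n))
  → (∀ n → 1 ≤ n → 1 ≤ a n)
  → 2 ≤ a 1
  → (∀ M → ∃ λ N → ∀ n → N ≤ n → M ≤ a n)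
  → ((∀ n → 1 ≤ n →
        ∃ λ b → (1 ≤ b)
          × (inv (a n) -ℚ inv (a (suc n) ∸ 1) <ℚ inv b)
          × (inv b <ℚ inv (a n ∸ 1) -ℚ inv (a (suc n)))
          × (∀ b′ → 1 ≤ b′
               → inv (a n) -ℚ inv (a (suc n) ∸ 1) <ℚ inv b′
               → inv b′ <ℚ inv (a n ∸ 1) -ℚ inv (a (suc n))
               → b′ ≡ b))
     ⇔
     ((∀ n → 1 ≤ n → (a n ≤ a (suc n) ∸ 2) × (2 ≤ a n))
      × (∀ n → 1 ≤ n →
           (((a (suc n) ∸ a n ∸ 1) ∣ (a n * a n))
             × SqrtLe ((+ 3 / 4) *ℚ ι (4 * a n * a n ∸ 4 * a n + 3))
                      (ι (a (suc n)) -ℚ ι (2 * a n) +ℚ (+ 1 / 2)))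
           ⊎
           ((¬ ((a (suc n) ∸ a n ∸ 1) ∣ (a n * a n)))
             × ((floor (ι (a n * a n) *ℚ inv (a (suc n) ∸ a n ∸ 1)) / 1)
                 ≤ℚ ι ((a n ∸ 1) * (a n ∸ 1)) *ℚ inv (a (suc n) ∸ a n + 1))))))
proposition4 a a-mono _ 2≤a₁ _ = mk⇔
  (λ unique → (λ n n≥1 → proj₁ (to (step n n≥1) (unique n n≥1)) , 2≤a n n≥1)
            , (λ n n≥1 → proj₂ (to (step n n≥1) (unique n n≥1))))
  (λ (bounds , conditions) n n≥1 → from (step n n≥1) (proj₁ (bounds n n≥1) , conditions n n≥1))
  where
  open Equivalence
  2≤a : ∀ n → 1 ≤ n → 2 ≤ a n
  2≤a (suc zero)    _ = 2≤a₁
  2≤a (suc (suc n)) _ = ℕ.≤-trans (2≤a (suc n) (s≤s z≤n)) (a-mono (suc n) (s≤s z≤n))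
  step : ∀ n → 1 ≤ n → UniqueSolution (Lower (a n) (a (suc n))) (Upper (a n) (a (suc n)))
    ⇔ (a n ≤ a (suc n) ∸ 2 × PaperCondition (a n) (a (suc n)) (a (suc n) ∸ a n ∸ 1) (a (suc n) ∸ a n + 1))
  step n n≥1 = uniqueSolution⇔paperCondition (2≤a n n≥1) (a-mono n n≥1)
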